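{- For a binary relation $R$ on a set $X$, the following are equivalent: (1) $R$ is anti-symmetric and semi-connex; (2) $R^9$ is the identity relation $\{(x,x):x\in X\}$; (3) $R^9$ is left unique; (4) $R^9$ is anti-symmetric; (5) $R^B$ is anti-symmetric; (6) $R^D$ is anti-symmetric.
   Context: Write $xRy$ for $(x,y)\in R$. Here $xR^9y$ iff ($xRy\land yRx$) or ($\lnot xRy\land\lnot yRx$); $xR^By$ iff $xRy\lor\lnot yRx$; $xR^Dy$ iff $\lnot xRy\lor yRx$. Anti-symmetric: $xRy\land x\ne y\to\lnot yRx$; semi-connex: $xRy\lor yRx\lor x=y$ for all $x,y$; left unique: $x_1Ry\land x_2Ry\to x_1=x_2$. -}

module Defs where

open import Level using (0ℓ)
open import Data.Product using (_×_)
open import Data.Sum using (_⊎_)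
open import Relation.Nullary using (¬_)
open import Relation.Binary.PropositionalEquality using (_≡_; _≢_)
open import Relation.Binary.Core using (Rel)
open import Function.Bundles using (_⇔_)

_⁹ : {X : Set} → Rel X 0ℓ → Rel X 0ℓ
(R ⁹) x y = (R x y × R y x) ⊎ (¬ R x y × ¬ R y x)

_ᴮ : {X : Set} → Rel X 0ℓ → Rel X 0ℓ
(R ᴮ) x y = R x y ⊎ ¬ R y x

_ᴰ : {X : Set} → Rel X 0ℓ → Rel X 0ℓ
(R ᴰ) x y = ¬ R x y ⊎ R y x

AntiSymmetric : {X : Set} → Rel X 0ℓ → Set
AntiSymmetric {X} R = ∀ (x y : X) → R x y → x ≢ y → ¬ R y x

SemiConnex : {X : Set} → Rel X 0ℓ → Set
SemiConnex {X} R = ∀ (x y : X) → R x y ⊎ R y x ⊎ x ≡ y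

LeftUnique : {X : Set} → Rel X 0ℓ → Set
LeftUnique {X} R = ∀ (x₁ x₂ y : X) → R x₁ y → R x₂ y → x₁ ≡ x₂

IsIdentityRel : {X : Set} → Rel X 0ℓ → Set
IsIdentityRel {X} R = ∀ (x y : X) → R x y ⇔ x ≡ y

{-# OPTIONS --safe #-}
-- R⁹ is the union of the symmetric part of R (pairs related both ways) and
-- the incomparable pairs (related neither way). Anti-symmetry of R says that the
-- first lies on the diagonal, semi-connexity that the second does, so (1) says
-- that R⁹ is coreflexive. Since R⁹ is reflexive, being the identity and being
-- left unique both mean the same. Anti-symmetry of any relation is
-- coreflexivity of its symmetric part, and the symmetric parts of R⁹, Rᴮ and
-- Rᴰ are all R⁹.
module Submission where

open import Defs
open import Level using (0ℓ)
open import Data.Empty using (⊥-elim)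
open import Data.Product using (_×_; _,_; proj₁; swap)
open import Data.Product.Function.NonDependent.Propositional using (_×-⇔_)
open import Data.Sum using (inj₁; inj₂; [_,_]; map) renaming (swap to ⊎-swap)
open import Function using (_∘_; id)
open import Function.Bundles using (_⇔_; mk⇔; Equivalence)
open import Function.Properties.Equivalence using ()
  renaming (sym to ⇔-sym; trans to ⇔-trans)
open import Relation.Nullary using (¬_)
open import Relation.Binary.Core using (Rel; _⇒_)
open import Relation.Binary.Definitions using (Reflexive; Symmetric)
open import Relation.Binary.Construct.Union using (_∪_)
open import Relation.Binary.PropositionalEquality using (_≡_; refl; sym; trans)
open import Axiom.ExcludedMiddle using (ExcludedMiddle)
open import Axiom.DoubleNegationElimination
  using (DoubleNegationElimination; em⇒dne)

Coreflexive : {X : Set} → Rel X 0ℓ → Set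
Coreflexive S = S ⇒ _≡_

SymmetricPart : {X : Set} → Rel X 0ℓ → Rel X 0ℓ
SymmetricPart S x y = S x y × S y x

Incomparable : {X : Set} → Rel X 0ℓ → Rel X 0ℓ
Incomparable R x y = ¬ R x y × ¬ R y x

Coreflexive-antimono : {X : Set} {S T : Rel X 0ℓ} →
  S ⇒ T → Coreflexive T → Coreflexive S
Coreflexive-antimono S⇒T c s = c (S⇒T s)

module _ {X : Set} {S T : Rel X 0ℓ} where

  Coreflexive-resp : S ⇒ T → T ⇒ S → Coreflexive S ⇔ Coreflexive T
  Coreflexive-resp S⇒T T⇒S =
    mk⇔ (Coreflexive-antimono T⇒S) (Coreflexive-antimono S⇒T)

  Coreflexive-∪ : Coreflexive (S ∪ T) ⇔ (Coreflexive S × Coreflexive T)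
  Coreflexive-∪ = mk⇔ split join
    where
    split : Coreflexive (S ∪ T) → Coreflexive S × Coreflexive T
    split c = (c ∘ inj₁) , (c ∘ inj₂)

    join : Coreflexive S × Coreflexive T → Coreflexive (S ∪ T)
    join (cS , cT) = [ cS , cT ]

module _ {X : Set} {S : Rel X 0ℓ} (S-refl : Reflexive S) where

  IsIdentityRel⇔Coreflexive : IsIdentityRel S ⇔ Coreflexive S
  IsIdentityRel⇔Coreflexive = mk⇔ to from
    where
    to : IsIdentityRel S → Coreflexive S
    to isId {x} {y} = Equivalence.to (isId x y)

    from : Coreflexive S → IsIdentityRel S
    from c x y = mk⇔ c λ { refl → S-refl }

  LeftUnique⇔Coreflexive : LeftUnique S ⇔ Coreflexive S
  LeftUnique⇔Coreflexive = mk⇔ to from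
    where
    to : LeftUnique S → Coreflexive S
    to lu {x} {y} s = lu x y y s S-refl

    from : Coreflexive S → LeftUnique S
    from c x₁ x₂ y s₁ s₂ = trans (c s₁) (sym (c s₂))

Coreflexive-SymmetricPart⇔Coreflexive : {X : Set} {S : Rel X 0ℓ} →
  Symmetric S → Coreflexive (SymmetricPart S) ⇔ Coreflexive S
Coreflexive-SymmetricPart⇔Coreflexive S-sym =
  Coreflexive-resp proj₁ (λ s → s , S-sym s)

module Classical (dne : DoubleNegationElimination 0ℓ) {X : Set} (R : Rel X 0ℓ) where

  AntiSymmetric⇔Coreflexive-SymmetricPart :
    AntiSymmetric R ⇔ Coreflexive (SymmetricPart R)
  AntiSymmetric⇔Coreflexive-SymmetricPart = mk⇔ to from
    where
    to : AntiSymmetric R → Coreflexive (SymmetricPart R)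
    to as {x} {y} (r , r′) = dne λ x≢y → as x y r x≢y r′

    from : Coreflexive (SymmetricPart R) → AntiSymmetric R
    from c x y r x≢y r′ = x≢y (c (r , r′))

  SemiConnex⇔Coreflexive-Incomparable :
    SemiConnex R ⇔ Coreflexive (Incomparable R)
  SemiConnex⇔Coreflexive-Incomparable = mk⇔ to from
    where
    to : SemiConnex R → Coreflexive (Incomparable R)
    to sc {x} {y} (¬r , ¬r′) =
      [ ⊥-elim ∘ ¬r , [ ⊥-elim ∘ ¬r′ , id ] ] (sc x y)

    from : Coreflexive (Incomparable R) → SemiConnex R
    from c x y = dne λ ¬sc →
      ¬sc (inj₂ (inj₂ (c (¬sc ∘ inj₁ , ¬sc ∘ inj₂ ∘ inj₁))))

  AntiSymmetric×SemiConnex⇔Coreflexive⁹ :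
    (AntiSymmetric R × SemiConnex R) ⇔ Coreflexive (R ⁹)
  AntiSymmetric×SemiConnex⇔Coreflexive⁹ = ⇔-trans
    (AntiSymmetric⇔Coreflexive-SymmetricPart ×-⇔ SemiConnex⇔Coreflexive-Incomparable)
    (⇔-sym Coreflexive-∪)

  ⁹-reflexive : Reflexive (R ⁹)
  ⁹-reflexive = dne λ ¬r⁹ → ¬r⁹ (inj₂ (twice λ r → ¬r⁹ (inj₁ (twice r))))
    where
    twice : {A : Set} → A → A × A
    twice a = a , a

  ⁹-symmetric : Symmetric (R ⁹)
  ⁹-symmetric = map swap swap

  SymmetricPart-ᴮ⇒⁹ : SymmetricPart (R ᴮ) ⇒ R ⁹
  SymmetricPart-ᴮ⇒⁹ (inj₁ r  , inj₁ r′) = inj₁ (r , r′)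
  SymmetricPart-ᴮ⇒⁹ (inj₁ r  , inj₂ ¬r) = ⊥-elim (¬r r)
  SymmetricPart-ᴮ⇒⁹ (inj₂ ¬r′ , inj₁ r′) = ⊥-elim (¬r′ r′)
  SymmetricPart-ᴮ⇒⁹ (inj₂ ¬r′ , inj₂ ¬r) = inj₂ (¬r , ¬r′)

  ⁹⇒SymmetricPart-ᴮ : R ⁹ ⇒ SymmetricPart (R ᴮ)
  ⁹⇒SymmetricPart-ᴮ (inj₁ (r , r′)) = inj₁ r , inj₁ r′
  ⁹⇒SymmetricPart-ᴮ (inj₂ (¬r , ¬r′)) = inj₂ ¬r′ , inj₂ ¬r

  -- x Rᴰ y is y Rᴮ x with the two disjuncts swapped.
  SymmetricPart-ᴰ⇒⁹ : SymmetricPart (R ᴰ) ⇒ R ⁹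
  SymmetricPart-ᴰ⇒⁹ (d , d′) = ⁹-symmetric (SymmetricPart-ᴮ⇒⁹ (⊎-swap d , ⊎-swap d′))

  ⁹⇒SymmetricPart-ᴰ : R ⁹ ⇒ SymmetricPart (R ᴰ)
  ⁹⇒SymmetricPart-ᴰ r⁹ with ⁹⇒SymmetricPart-ᴮ (⁹-symmetric r⁹)
  ... | b , b′ = ⊎-swap b , ⊎-swap b′

open Classical

mainTheorem11 : ExcludedMiddle 0ℓ → (X : Set) → (R : Rel X 0ℓ) →
    let S1 = AntiSymmetric R × SemiConnex R in
    (S1 ⇔ IsIdentityRel (R ⁹)) × (S1 ⇔ LeftUnique (R ⁹)) ×
    (S1 ⇔ AntiSymmetric (R ⁹)) × (S1 ⇔ AntiSymmetric (R ᴮ)) ×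
    (S1 ⇔ AntiSymmetric (R ᴰ))
mainTheorem11 em X R =
    via (IsIdentityRel⇔Coreflexive (⁹-reflexive dne R))
  , via (LeftUnique⇔Coreflexive (⁹-reflexive dne R))
  , via (⇔-trans (AntiSymmetric⇔Coreflexive-SymmetricPart dne (R ⁹))
                 (Coreflexive-SymmetricPart⇔Coreflexive (⁹-symmetric dne R)))
  , via (⇔-trans (AntiSymmetric⇔Coreflexive-SymmetricPart dne (R ᴮ))
                 (Coreflexive-resp (SymmetricPart-ᴮ⇒⁹ dne R) (⁹⇒SymmetricPart-ᴮ dne R)))
  , via (⇔-trans (AntiSymmetric⇔Coreflexive-SymmetricPart dne (R ᴰ))
                 (Coreflexive-resp (SymmetricPart-ᴰ⇒⁹ dne R) (⁹⇒SymmetricPart-ᴰ dne R)))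
  where
  dne : DoubleNegationElimination 0ℓ
  dne = em⇒dne em

  via : {P : Set} → P ⇔ Coreflexive (R ⁹) → (AntiSymmetric R × SemiConnex R) ⇔ P
  via P⇔ = ⇔-trans (AntiSymmetric×SemiConnex⇔Coreflexive⁹ dne R) (⇔-sym P⇔)
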